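{- Let $k$ be a fixed positive integer. Then $$\lim_{n\to\infty}\frac{\operatorname{mc}(C_n^k)}{kn/d_k}=1,$$ i.e. $\operatorname{mc}(C_n^k)=\frac{kn}{d_k}(1-o(1))$ as $n\to\infty$, where $d_k=\frac{k}{k-a_k}$.
   Context: $C_n^k$ is the graph on vertices $v_1,\ldots,v_n$ in which $v_i$ and $v_j$ ($i\neq j$) are adjacent iff $\min(|i-j|,n-|i-j|)\leq k$. For a graph $G$, $\operatorname{mc}(G)$ is the maximum, over all partitions of $V(G)$ into two sets, of the number of edges joining the two sets. The de Bruijn graph $B_k$ is the directed graph whose vertices are all binary strings of length $k$, with an arc from $u_1\ldots u_k$ to $v_1\ldots v_k$ whenever $u_2\ldots u_k=v_1\ldots v_{k-1}$; this arc is identified with the binary string $e=e_0e_1\ldots e_k=u_1v_1\ldots v_k$. The weight $t_k(e)$ of an arc is the number of $i\in\{1,\ldots,k\}$ with $e_i=e_0$. A cycle in $B_k$ is a closed directed walk with at least one arc and no repeated vertices; its weight $t_k(C)$ is the sum of weights of its arcs and $|C|$ its number of arcs. $a_k=\min\{t_k(C)/|C|: C\text{ a cycle in }B_k\}$. -}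

module Defs where

open import Data.Bool using (Bool; true; false; _∧_; _xor_; if_then_else_)
open import Data.Nat using (ℕ; zero; suc; _+_; _∸_; _⊔_; _⊓_; _≤ᵇ_; _<ᵇ_)
open import Data.Fin using (Fin; toℕ; fromℕ; inject₁) renaming (zero to fzero; suc to fsuc)
open import Data.List using (List; []; _∷_; map; foldr; allFin; concatMap)
open import Data.Nat.ListAction using (sum)
open import Data.Vec using (Vec; []; _∷_; lookup; head; tail; init)
open import Data.Integer using (+_)
open import Data.Rational using (ℚ; _/_; _≤_)
open import Data.Product using (Σ; ∃; _×_; _,_)
open import Function.Definitions using (Injective)
open import Relation.Binary.PropositionalEquality using (_≡_)

-- The circulant graph C_n^k on vertices 0,…,n-1 (v_{i+1} ↦ i).
-- i ≠ j adjacent iff min(|i-j|, n-|i-j|) ≤ k.  For i < j, |i-j| = j ∸ i.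

adjLt : (n k i j : ℕ) → Bool
adjLt n k i j = (i <ᵇ j) ∧ (((j ∸ i) ⊓ (n ∸ (j ∸ i))) ≤ᵇ k)

cutSize : (n k : ℕ) → Vec Bool n → ℕ
cutSize n k s =
  sum (concatMap (λ (i : Fin n) → map (λ (j : Fin n) →
        if adjLt n k (toℕ i) (toℕ j) ∧ (lookup s i xor lookup s j) then 1 else 0)
        (allFin n)) (allFin n))

allBool : (n : ℕ) → List (Vec Bool n)
allBool zero = [] ∷ []
allBool (suc n) = concatMap (λ v → (false ∷ v) ∷ (true ∷ v) ∷ []) (allBool n)

mc : (n k : ℕ) → ℕ
mc n k = foldr _⊔_ 0 (map (cutSize n k) (allBool n))

-- De Bruijn graph B_k.  Vertices: Vec Bool k.  An arc is identified with
-- its string e = e_0 e_1 … e_k : Vec Bool (suc k); its tail vertex is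
-- e_0 … e_{k-1} and its head vertex is e_1 … e_k.

arcSource : {k : ℕ} → Vec Bool (suc k) → Vec Bool k
arcSource e = init e

arcTarget : {k : ℕ} → Vec Bool (suc k) → Vec Bool k
arcTarget e = tail e

eqBool : Bool → Bool → Bool
eqBool true true = true
eqBool false false = true
eqBool _ _ = false

countEq : {k : ℕ} → Bool → Vec Bool k → ℕ
countEq b [] = 0
countEq b (x ∷ xs) = (if eqBool x b then 1 else 0) + countEq b xs

arcWeight : {k : ℕ} → Vec Bool (suc k) → ℕ
arcWeight (e₀ ∷ es) = countEq e₀ es

record Cycle (k : ℕ) : Set where
  field
    m      : ℕ
    arcs   : Fin (suc m) → Vec Bool (suc k)
    linked : (i : Fin m) → arcTarget (arcs (inject₁ i)) ≡ arcSource (arcs (fsuc i))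
    closed : arcTarget (arcs (fromℕ m)) ≡ arcSource (arcs fzero)
    simple : Injective _≡_ _≡_ (λ i → arcSource (arcs i))

cycleLength : {k : ℕ} → Cycle k → ℕ
cycleLength C = suc (Cycle.m C)

cycleWeight : {k : ℕ} → Cycle k → ℕ
cycleWeight C = sum (map (λ i → arcWeight (Cycle.arcs C i)) (allFin (suc (Cycle.m C))))

cycleRatio : {k : ℕ} → Cycle k → ℚ
cycleRatio C = + cycleWeight C / suc (Cycle.m C)

-- a is the value a_k = min { t_k(C)/|C| : C a cycle in B_k }
IsA : (k : ℕ) → ℚ → Set
IsA k a = (Σ (Cycle k) λ C → cycleRatio C ≡ a) × ((C : Cycle k) → a ≤ cycleRatio C)

module Submission where

-- For n ≥ 2k+1 every vertex i of C_n^k has exactly k forward neighbours i+1, …, i+k, and every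
-- edge is forward from exactly one of its ends.  Reading a colouring s cyclically, the window
-- s_i s_{i+1} … s_{i+k} is an arc of B_k whose weight counts the forward neighbours of i on the
-- same side as i, so  cut(s) + Σ_i t_k(window i) = kn.  The n windows form a closed walk in B_k,
-- which decomposes into cycles, so Σ_i t_k(window i) ≥ a_k n and mc(C_n^k) ≤ (k − a_k) n.
-- Conversely, unrolling a cycle C with t_k(C)/|C| = a_k into a periodic colouring makes every
-- window an arc of C except the k windows that wrap around, so mc(C_n^k) ≥ (k − a_k) n − t_k(C) − k².
-- The alternating 2-cycle shows a_k < k, so this error is eventually below ε (k − a_k) n.

open import Defs
open import Data.Nat.Base using (ℕ; zero; suc)
open import Data.Rational.Base using (ℚ)
open import Data.Bool using (Bool; true; false; not; _∧_; _xor_; if_then_else_)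
open import Data.Fin using (Fin; toℕ; fromℕ; fromℕ<; inject₁) renaming (zero to fzero; suc to fsuc)
open import Data.Vec using (Vec; []; _∷_; lookup; tabulate; init; tail)
open import Data.Product using (∃; ∃₂; _,_; proj₁; proj₂)
open import Data.Sum using (_⊎_; inj₁; inj₂)
open import Data.Empty using (⊥-elim)
open import Relation.Nullary using (¬_; yes; no)
open import Relation.Binary.PropositionalEquality
open import Function using (_∘_; id)

module RangeSum where

  open import Data.Nat
  open import Data.Nat.Properties
  open import Algebra.Properties.CommutativeSemigroup +-commutativeSemigroup using (interchange)
  open import Data.List as List using (List; _∷_; [])
  open import Data.List.Properties using (map-tabulate)
  open import Data.Nat.ListAction using (sum)
  open import Data.Nat.ListAction.Properties using (sum-++)

  ∑ : ℕ → (ℕ → ℕ) → ℕ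
  ∑ zero    f = 0
  ∑ (suc n) f = f 0 + ∑ n (f ∘ suc)

  syntax ∑ n (λ j → e) = ∑[ j < n ] e

  ∑-snoc : ∀ n f → ∑ (suc n) f ≡ ∑ n f + f n
  ∑-snoc zero    f = +-comm (f 0) 0
  ∑-snoc (suc n) f = trans (cong (f 0 +_) (∑-snoc n (f ∘ suc))) (sym (+-assoc (f 0) _ _))

  ∑-cong-< : ∀ n {f h : ℕ → ℕ} → (∀ j → j < n → f j ≡ h j) → ∑ n f ≡ ∑ n h
  ∑-cong-< zero    eq = refl
  ∑-cong-< (suc n) eq = cong₂ _+_ (eq 0 z<s) (∑-cong-< n (λ j j<n → eq (suc j) (s<s j<n)))

  ∑-cong : ∀ n {f h : ℕ → ℕ} → (∀ j → f j ≡ h j) → ∑ n f ≡ ∑ n h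
  ∑-cong n eq = ∑-cong-< n (λ j _ → eq j)

  ∑-distrib-+ : ∀ n f h → ∑[ j < n ] (f j + h j) ≡ ∑ n f + ∑ n h
  ∑-distrib-+ zero    f h = refl
  ∑-distrib-+ (suc n) f h =
    trans (cong (f 0 + h 0 +_) (∑-distrib-+ n (f ∘ suc) (h ∘ suc)))
          (interchange (f 0) (h 0) (∑ n (f ∘ suc)) (∑ n (h ∘ suc)))

  ∑-split : ∀ m l f → ∑ (m + l) f ≡ ∑ m f + ∑[ d < l ] f (m + d)
  ∑-split zero    l f = refl
  ∑-split (suc m) l f = trans (cong (f 0 +_) (∑-split m l (f ∘ suc))) (sym (+-assoc (f 0) _ _))

  ∑-const : ∀ n c → ∑[ _ < n ] c ≡ n * c
  ∑-const zero    c = refl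
  ∑-const (suc n) c = cong (c +_) (∑-const n c)

  ∑-mono-≤ : ∀ n {f h : ℕ → ℕ} → (∀ j → j < n → f j ≤ h j) → ∑ n f ≤ ∑ n h
  ∑-mono-≤ zero    le = z≤n
  ∑-mono-≤ (suc n) le = +-mono-≤ (le 0 z<s) (∑-mono-≤ n (λ j j<n → le (suc j) (s<s j<n)))

  ∑-≤-const : ∀ n c {f : ℕ → ℕ} → (∀ j → j < n → f j ≤ c) → ∑ n f ≤ n * c
  ∑-≤-const n c le = subst (_ ≤_) (∑-const n c) (∑-mono-≤ n le)

  ∑-≤-∑-+ : ∀ m l f → ∑ m f ≤ ∑ (m + l) f
  ∑-≤-∑-+ m l f = subst (∑ m f ≤_) (sym (∑-split m l f)) (m≤m+n _ _)

  ∑-comm : ∀ n m (F : ℕ → ℕ → ℕ) → ∑[ i < n ] ∑[ j < m ] F i j ≡ ∑[ j < m ] ∑[ i < n ] F i j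
  ∑-comm zero    m F = sym (trans (∑-const m 0) (*-zeroʳ m))
  ∑-comm (suc n) m F = trans (cong (∑ m (F 0) +_) (∑-comm n m (F ∘ suc)))
                             (sym (∑-distrib-+ m (F 0) (λ j → ∑[ i < n ] F (suc i) j)))

  ∑-reverse : ∀ n f → ∑[ d < n ] f (n ∸ suc d) ≡ ∑ n f
  ∑-reverse zero    f = refl
  ∑-reverse (suc n) f = trans (cong (f n +_) (∑-reverse n f)) (trans (+-comm (f n) _) (sym (∑-snoc n f)))

  sum-tabulate : ∀ n {f : Fin n → ℕ} (G : ℕ → ℕ) → (∀ i → f i ≡ G (toℕ i)) → sum (List.tabulate f) ≡ ∑ n G
  sum-tabulate zero    G eq = refl
  sum-tabulate (suc n) G eq = cong₂ _+_ (eq fzero) (sum-tabulate n (G ∘ suc) (eq ∘ fsuc))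

  sum-allFin : ∀ n (f : Fin n → ℕ) → sum (List.map f (List.allFin n)) ≡ sum (List.tabulate f)
  sum-allFin n f = cong sum (map-tabulate id f)

  sum-concatMap : ∀ {A : Set} (h : A → List ℕ) xs →
    sum (List.concatMap h xs) ≡ sum (List.map (sum ∘ h) xs)
  sum-concatMap h []       = refl
  sum-concatMap h (x ∷ xs) = trans (sum-++ (h x) (List.concatMap h xs)) (cong (sum (h x) +_) (sum-concatMap h xs))

  module _ (L : ℕ) {f : ℕ → ℕ} (periodic : ∀ x → f (x + L) ≡ f x) where

    ∑-rotate : ∀ c → ∑[ j < L ] f (c + j) ≡ ∑ L f
    ∑-rotate zero    = refl
    ∑-rotate (suc c) = begin
      ∑[ j < L ] f (suc c + j)         ≡⟨ ∑-cong L (λ j → cong f (sym (+-suc c j))) ⟩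
      ∑[ j < L ] f (c + suc j)         ≡⟨ +-cancelˡ-≡ (f c) _ _ shift ⟩
      ∑[ j < L ] f (c + j)             ≡⟨ ∑-rotate c ⟩
      ∑ L f                            ∎
      where
      open ≡-Reasoning
      shift : f c + ∑[ j < L ] f (c + suc j) ≡ f c + ∑[ j < L ] f (c + j)
      shift = begin
        f c + ∑[ j < L ] f (c + suc j)   ≡⟨ cong (λ x → f x + ∑[ j < L ] f (c + suc j)) (sym (+-identityʳ c)) ⟩
        ∑[ j < suc L ] f (c + j)         ≡⟨ ∑-snoc L (λ j → f (c + j)) ⟩
        ∑[ j < L ] f (c + j) + f (c + L) ≡⟨ cong (∑[ j < L ] f (c + j) +_) (periodic c) ⟩
        ∑[ j < L ] f (c + j) + f c       ≡⟨ +-comm _ (f c) ⟩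
        f c + ∑[ j < L ] f (c + j)       ∎

    periodicˡ : ∀ x → f (L + x) ≡ f x
    periodicˡ x = trans (cong f (+-comm L x)) (periodic x)

    periodic-* : ∀ q x → f (q * L + x) ≡ f x
    periodic-* zero    x = refl
    periodic-* (suc q) x = trans (cong f (+-assoc L (q * L) x)) (trans (periodicˡ _) (periodic-* q x))

    ∑-repeat : ∀ q → ∑ (q * L) f ≡ q * ∑ L f
    ∑-repeat zero    = refl
    ∑-repeat (suc q) = trans (∑-split L (q * L) f)
      (cong (∑ L f +_) (trans (∑-cong (q * L) periodicˡ) (∑-repeat q)))

module BitStrings where

  open import Data.Nat
  open import Data.Nat.Properties
  open import Algebra.Properties.CommutativeSemigroup +-commutativeSemigroup using (interchange)
  open RangeSum using (∑)

  𝟙 : Bool → ℕ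
  𝟙 b = if b then 1 else 0

  -- Junk value false past the end of the vector.
  bitAt : ∀ {m} → Vec Bool m → ℕ → Bool
  bitAt []       _       = false
  bitAt (x ∷ xs) zero    = x
  bitAt (x ∷ xs) (suc t) = bitAt xs t

  lookup≡bitAt : ∀ {m} (v : Vec Bool m) (i : Fin m) → lookup v i ≡ bitAt v (toℕ i)
  lookup≡bitAt (x ∷ v) fzero    = refl
  lookup≡bitAt (x ∷ v) (fsuc i) = lookup≡bitAt v i

  bitAt-tail : ∀ {m} (v : Vec Bool (suc m)) t → bitAt v (suc t) ≡ bitAt (tail v) t
  bitAt-tail (x ∷ v) t = refl

  bitAt-init : ∀ {m} (v : Vec Bool (suc m)) t → t < m → bitAt (init v) t ≡ bitAt v t
  bitAt-init (x ∷ y ∷ v) zero    _         = refl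
  bitAt-init (x ∷ y ∷ v) (suc t) (s≤s t<m) = bitAt-init (y ∷ v) t t<m

  bitAt-tabulate : ∀ {m} (h : ℕ → Bool) t → t < m → bitAt (tabulate {n = m} (h ∘ toℕ)) t ≡ h t
  bitAt-tabulate {suc m} h zero    _         = refl
  bitAt-tabulate {suc m} h (suc t) (s≤s t<m) = bitAt-tabulate {m} (h ∘ suc) t t<m

  init-tabulate : ∀ {A : Set} m (f : Fin (suc m) → A) → init (tabulate f) ≡ tabulate (f ∘ inject₁)
  init-tabulate zero    f = refl
  init-tabulate (suc m) f = cong (f fzero ∷_) (init-tabulate m (f ∘ fsuc))

  bitAt-injective : ∀ {m} (u v : Vec Bool m) → (∀ t → t < m → bitAt u t ≡ bitAt v t) → u ≡ v
  bitAt-injective []      []      _  = refl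
  bitAt-injective (x ∷ u) (y ∷ v) eq =
    cong₂ _∷_ (eq 0 z<s) (bitAt-injective u v (λ t t<m → eq (suc t) (s<s t<m)))

  countEq-≤ : ∀ {m} b (v : Vec Bool m) → countEq b v ≤ m
  countEq-≤ b []      = z≤n
  countEq-≤ b (x ∷ v) with eqBool x b
  ... | true  = s≤s (countEq-≤ b v)
  ... | false = m≤n⇒m≤1+n (countEq-≤ b v)

  arcWeight-≤ : ∀ {k} (e : Vec Bool (suc k)) → arcWeight e ≤ k
  arcWeight-≤ (e₀ ∷ es) = countEq-≤ e₀ es

  match+mismatch≡1 : ∀ b c → 𝟙 (eqBool c b) + 𝟙 (b xor c) ≡ 1
  match+mismatch≡1 true  true  = refl
  match+mismatch≡1 true  false = refl
  match+mismatch≡1 false true  = refl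
  match+mismatch≡1 false false = refl

  countEq+mismatches≡length : ∀ m (h : ℕ → Bool) b →
    countEq b (tabulate {n = m} (h ∘ toℕ)) + ∑[ d < m ] 𝟙 (b xor h d) ≡ m
  countEq+mismatches≡length zero    h b = refl
  countEq+mismatches≡length (suc m) h b =
    trans (interchange (𝟙 (eqBool (h 0) b)) (countEq b (tabulate {n = m} (h ∘ suc ∘ toℕ)))
                       (𝟙 (b xor h 0)) (∑[ d < m ] 𝟙 (b xor h (suc d))))
          (cong₂ _+_ (match+mismatch≡1 b (h 0)) (countEq+mismatches≡length m (h ∘ suc) b))

module DeBruijnWalks (k : ℕ) where

  open import Data.Nat
  open import Data.Nat.Properties
  open import Data.Bool.Properties using () renaming (_≟_ to _≟ᵇ_)
  open import Data.Vec.Properties using (≡-dec)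
  open import Data.List using () renaming (tabulate to tabulateˡ)
  open import Data.Nat.ListAction using (sum)
  open RangeSum using (sum-allFin)

  Vertex : Set
  Vertex = Vec Bool k

  Arc : Set
  Arc = Vec Bool (suc k)

  data Walk : ℕ → Vertex → Vertex → Set where
    nil  : ∀ {u} → Walk 0 u u
    cons : ∀ {n u v} (e : Arc) → init e ≡ u → Walk n (tail e) v → Walk (suc n) u v

  weight : ∀ {n u v} → Walk n u v → ℕ
  weight nil          = 0
  weight (cons e _ p) = arcWeight e + weight p

  arcAt : ∀ {n u v} → Walk n u v → Fin n → Arc
  arcAt (cons e _ p) fzero    = e
  arcAt (cons e _ p) (fsuc j) = arcAt p j

  _++ʷ_ : ∀ {m n u w v} → Walk m u w → Walk n w v → Walk (m + n) u v
  nil          ++ʷ q = q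
  cons e eq p  ++ʷ q = cons e eq (p ++ʷ q)

  weight-++ʷ : ∀ {m n u w v} (p : Walk m u w) (q : Walk n w v) → weight (p ++ʷ q) ≡ weight p + weight q
  weight-++ʷ nil          q = refl
  weight-++ʷ (cons e _ p) q = trans (cong (arcWeight e +_) (weight-++ʷ p q)) (sym (+-assoc (arcWeight e) _ _))

  stay : ∀ {u v} → u ≡ v → Walk 0 u v
  stay refl = nil

  weight-stay : ∀ {u v} (eq : u ≡ v) → weight (stay eq) ≡ 0
  weight-stay refl = refl

  Simple : ∀ {n u v} → Walk n u v → Set
  Simple p = ∀ i j → init (arcAt p i) ≡ init (arcAt p j) → i ≡ j

  Avoids : ∀ {n u v} → Vertex → Walk n u v → Set
  Avoids w p = ∀ j → ¬ init (arcAt p j) ≡ w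

  record Visit {n u v} (w : Vertex) (p : Walk n u v) : Set where
    constructor visit
    field
      {m₁ m₂} : ℕ
      before  : Walk m₁ u w
      after   : Walk (suc m₂) w v
      length≡ : m₁ + suc m₂ ≡ n
      weight≡ : weight before + weight after ≡ weight p

  visit? : ∀ {n u v} (w : Vertex) (p : Walk n u v) → Avoids w p ⊎ Visit w p
  visit? w nil = inj₁ (λ ())
  visit? w (cons e eq p) with ≡-dec _≟ᵇ_ (init e) w
  ... | yes e↦w = inj₂ (visit (stay (trans (sym eq) e↦w)) (cons e e↦w p) refl
                          (cong (_+ _) (weight-stay (trans (sym eq) e↦w))))
  ... | no  e↛w with visit? w p
  ...   | inj₁ avoids = inj₁ λ { fzero → e↛w ; (fsuc j) → avoids j }
  ...   | inj₂ (visit p₁ p₂ len wt) = inj₂ (visit (cons e eq p₁) p₂ (cong suc len)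
                                          (trans (+-assoc (arcWeight e) _ _) (cong (arcWeight e +_) wt)))

  record LoopSplit {n u v} (p : Walk n u v) : Set where
    constructor loopSplit
    field
      {w}        : Vertex
      {m₁ m₂ m₃} : ℕ
      before     : Walk m₁ u w
      loop       : Walk (suc m₂) w w
      after      : Walk (suc m₃) w v
      length≡    : m₁ + suc m₂ + suc m₃ ≡ n
      weight≡    : weight before + weight loop + weight after ≡ weight p

  simple-or-loop : ∀ {n u v} (p : Walk n u v) → Simple p ⊎ LoopSplit p
  simple-or-loop nil = inj₁ (λ ())
  simple-or-loop (cons e eq p) with visit? (init e) p
  ... | inj₂ (visit p₁ p₂ len wt) =
        inj₂ (loopSplit (stay (sym eq)) (cons e refl p₁) p₂ (cong suc len)
               (trans (cong (λ x → x + _ + _) (weight-stay (sym eq)))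
                      (trans (+-assoc (arcWeight e) _ _) (cong (arcWeight e +_) wt))))
  ... | inj₁ avoids with simple-or-loop p
  ...   | inj₂ (loopSplit p₁ p₂ p₃ len wt) =
          inj₂ (loopSplit (cons e eq p₁) p₂ p₃ (cong suc len)
                 (trans (cong (_+ weight p₃) (+-assoc (arcWeight e) (weight p₁) (weight p₂)))
                        (trans (+-assoc (arcWeight e) _ _) (cong (arcWeight e +_) wt))))
  ...   | inj₁ simple = inj₁ λ { fzero    fzero    _ → refl
                               ; fzero    (fsuc j) h → ⊥-elim (avoids j (sym h))
                               ; (fsuc i) fzero    h → ⊥-elim (avoids i h)
                               ; (fsuc i) (fsuc j) h → cong fsuc (simple i j h) }

  init-arcAt-first : ∀ {m u v} (p : Walk (suc m) u v) → init (arcAt p fzero) ≡ u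
  init-arcAt-first (cons e eq p) = eq

  tail-arcAt-last : ∀ {m u v} (p : Walk (suc m) u v) → tail (arcAt p (fromℕ m)) ≡ v
  tail-arcAt-last {zero}  (cons e eq nil) = refl
  tail-arcAt-last {suc m} (cons e eq p)   = tail-arcAt-last p

  arcAt-linked : ∀ {m u v} (p : Walk (suc m) u v) (i : Fin m) →
    tail (arcAt p (inject₁ i)) ≡ init (arcAt p (fsuc i))
  arcAt-linked (cons e eq (cons e′ eq′ p)) fzero    = sym eq′
  arcAt-linked (cons e eq p@(cons _ _ _))  (fsuc i) = arcAt-linked p i

  toCycle : ∀ {m u} (p : Walk (suc m) u u) → Simple p → Cycle k
  toCycle {m} p simple = record
    { m      = m
    ; arcs   = arcAt p
    ; linked = arcAt-linked p
    ; closed = trans (tail-arcAt-last p) (sym (init-arcAt-first p))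
    ; simple = λ {i} {j} → simple i j
    }

  sum-arcWeights : ∀ {n u v} (p : Walk n u v) → sum (tabulateˡ (arcWeight ∘ arcAt p)) ≡ weight p
  sum-arcWeights nil          = refl
  sum-arcWeights (cons e _ p) = cong (arcWeight e +_) (sum-arcWeights p)

  cycleWeight-toCycle : ∀ {m u} (p : Walk (suc m) u u) (simple : Simple p) →
    cycleWeight (toCycle p simple) ≡ weight p
  cycleWeight-toCycle {m} p _ = trans (sum-allFin (suc m) (arcWeight ∘ arcAt p)) (sum-arcWeights p)

module Rationals where

  open import Data.Nat as ℕ using (z≤n)
  import Data.Nat.Properties as ℕₚ
  open import Data.Integer as ℤ using (ℤ; +_; +[1+_])
  import Data.Integer.Properties as ℤₚ
  open import Data.Rational
  open import Data.Rational.Properties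
  open import Data.Rational.Solver using (module +-*-Solver)
  import Data.Rational.Unnormalised as ℚᵘ
  import Data.Rational.Unnormalised.Properties as ℚᵘₚ
  open import Data.Nat.Coprimality using (1-coprimeTo) renaming (sym to coprime-sym)
  open +-*-Solver

  ι : ℕ → ℚ
  ι m = + m / 1

  ι≡mkℚ : ∀ m → ι m ≡ mkℚ (+ m) 0 (coprime-sym (1-coprimeTo m))
  ι≡mkℚ m = ↥p/↧p≡p (mkℚ (+ m) 0 (coprime-sym (1-coprimeTo m)))

  ι-+ : ∀ m n → ι (m ℕ.+ n) ≡ ι m + ι n
  ι-+ m n rewrite ι≡mkℚ m | ι≡mkℚ n = /-cong {p₁ = + (m ℕ.+ n)}
    (sym (trans (cong₂ ℤ._+_ (ℤₚ.*-identityʳ (+ m)) (ℤₚ.*-identityʳ (+ n))) (sym (ℤₚ.pos-+ m n)))) refl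

  ι-* : ∀ m n → ι (m ℕ.* n) ≡ ι m * ι n
  ι-* m n rewrite ι≡mkℚ m | ι≡mkℚ n = /-cong (ℤₚ.pos-* m n) refl

  ι-mono-≤ : ∀ {m n} → m ℕ.≤ n → ι m ≤ ι n
  ι-mono-≤ {m} {n} m≤n rewrite ι≡mkℚ m | ι≡mkℚ n =
    *≤* (subst₂ ℤ._≤_ (sym (ℤₚ.*-identityʳ (+ m))) (sym (ℤₚ.*-identityʳ (+ n))) (ℤ.+≤+ m≤n))

  ι-mono-< : ∀ {m n} → m ℕ.< n → ι m < ι n
  ι-mono-< {m} {n} m<n rewrite ι≡mkℚ m | ι≡mkℚ n =
    *<* (subst₂ ℤ._<_ (sym (ℤₚ.*-identityʳ (+ m))) (sym (ℤₚ.*-identityʳ (+ n))) (ℤ.+<+ m<n))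

  ι-nonNeg : ∀ m → NonNegative (ι m)
  ι-nonNeg m = nonNegative (ι-mono-≤ {0} {m} z≤n)

  ι-*-/-cancel : ∀ (i : ℤ) l → ι (suc l) * (i / suc l) ≡ i / 1
  ι-*-/-cancel i l = toℚᵘ-injective (ℚᵘₚ.≃-trans (toℚᵘ-homo-* (ι (suc l)) (i / suc l))
    (ℚᵘₚ.≃-trans (ℚᵘₚ.*-cong (toℚᵘ-cong (ι≡mkℚ (suc l))) (toℚᵘ-fromℚᵘ (ℚᵘ.mkℚᵘ i l)))
    (ℚᵘₚ.≃-trans (ℚᵘ.*≡* cross) (ℚᵘₚ.≃-sym (toℚᵘ-fromℚᵘ (ℚᵘ.mkℚᵘ i 0))))))
    where
    cross : (+ suc l ℤ.* i) ℤ.* + 1 ≡ i ℤ.* (+ 1 ℤ.* + suc l)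
    cross = trans (ℤₚ.*-identityʳ _) (trans (ℤₚ.*-comm (+ suc l) i) (cong (i ℤ.*_) (sym (ℤₚ.*-identityˡ (+ suc l)))))

  p+q≡r*s⇒p≤r*[s-a] : ∀ {p q r s} a → p + q ≡ r * s → a * r ≤ q → p ≤ r * (s - a)
  p+q≡r*s⇒p≤r*[s-a] {p} {q} {r} {s} a eq ar≤q =
    subst₂ _≤_ (sym p≡rs-q) (sym (solve 3 (λ r s a → r :* (s :- a) := r :* s :- a :* r) refl r s a))
      (+-monoʳ-≤ (r * s) (neg-antimono-≤ ar≤q))
    where
    p≡rs-q : p ≡ r * s - q
    p≡rs-q = trans (solve 2 (λ p q → p := (p :+ q) :- q) refl p q) (cong (_- q) eq)

  p+q≡r*s⇒r*[s-a]≤p+e : ∀ {p q r s} a e → p + q ≡ r * s → q ≤ r * a + e → r * (s - a) ≤ p + e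
  p+q≡r*s⇒r*[s-a]≤p+e {p} {q} {r} {s} a e eq q≤ra+e =
    subst₂ _≤_ (sym (solve 3 (λ r s a → r :* (s :- a) := r :* s :- r :* a) refl r s a))
               (solve 3 (λ p e x → (p :+ e) :+ x :- x := p :+ e) refl p e (r * a))
      (+-monoˡ-≤ (- (r * a)) rs≤p+e+ra)
    where
    rs≤p+e+ra : r * s ≤ (p + e) + r * a
    rs≤p+e+ra = subst₂ _≤_ eq (solve 4 (λ p r a e → p :+ (r :* a :+ e) := (p :+ e) :+ r :* a) refl p r a e)
                  (+-monoʳ-≤ p q≤ra+e)

  p≤q≤p+e⇒∣p-q∣≤e : ∀ {p q e} → p ≤ q → q ≤ p + e → ∣ p - q ∣ ≤ e
  p≤q≤p+e⇒∣p-q∣≤e {p} {q} {e} p≤q q≤p+e = subst (_≤ e) (sym ∣p-q∣≡q-p) q-p≤e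
    where
    0≤q-p : 0ℚ ≤ q - p
    0≤q-p = subst (_≤ q - p) (+-inverseʳ p) (+-monoˡ-≤ (- p) p≤q)
    ∣p-q∣≡q-p : ∣ p - q ∣ ≡ q - p
    ∣p-q∣≡q-p = trans (sym (∣-p∣≡∣p∣ (p - q)))
      (trans (cong ∣_∣ (solve 2 (λ p q → :- (p :- q) := q :- p) refl p q)) (0≤p⇒∣p∣≡p 0≤q-p))
    q-p≤e : q - p ≤ e
    q-p≤e = subst (q - p ≤_) (solve 2 (λ p e → p :+ e :- p := e) refl p e) (+-monoˡ-≤ (- p) q≤p+e)

  archimedean : ∀ r → Positive r → ∀ m → ∃ λ N → ∀ n → N ℕ.≤ n → ι m ≤ ι n * r
  archimedean r@(mkℚ +[1+ p ] d _) _ m = m ℕ.* suc d , λ n N≤n → begin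
    ι m                      ≤⟨ ι-mono-≤ (ℕₚ.m≤m*n m (suc p)) ⟩
    ι (m ℕ.* suc p)          ≡⟨ ι-* m (suc p) ⟩
    ι m * ι (suc p)          ≡⟨ cong (ι m *_) (sym (trans (cong (ι (suc d) *_) (sym (↥p/↧p≡p r)))
                                                         (ι-*-/-cancel +[1+ p ] d))) ⟩
    ι m * (ι (suc d) * r)    ≡⟨ sym (trans (cong (_* r) (ι-* m (suc d))) (*-assoc (ι m) (ι (suc d)) r)) ⟩
    ι (m ℕ.* suc d) * r      ≤⟨ *-monoʳ-≤-nonNeg r {{pos⇒nonNeg r}} (ι-mono-≤ N≤n) ⟩
    ι n * r                  ∎
    where open ≤-Reasoning

module ClosedWalkBound (k : ℕ) (a : ℚ) (isA : IsA k a) where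

  import Data.Nat as ℕ
  import Data.Nat.Properties as ℕₚ
  open import Data.Nat.Tactic.RingSolver using (solve-∀)
  open import Data.Integer using (+_)
  open import Data.Rational
  open import Data.Rational.Properties
  open DeBruijnWalks k
  open Rationals

  simpleWalk-weight-≥ : ∀ {n u} (p : Walk n u u) → Simple p → a * ι n ≤ ι (weight p)
  simpleWalk-weight-≥ nil _ = ≤-reflexive (*-zeroʳ a)
  simpleWalk-weight-≥ {suc m} p@(cons _ _ _) simple = begin
    a * ι (suc m)                   ≤⟨ *-monoʳ-≤-nonNeg (ι (suc m)) {{ι-nonNeg (suc m)}} (proj₂ isA C) ⟩
    cycleRatio C * ι (suc m)        ≡⟨ *-comm (cycleRatio C) (ι (suc m)) ⟩
    ι (suc m) * cycleRatio C        ≡⟨ ι-*-/-cancel (+ cycleWeight C) m ⟩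
    ι (cycleWeight C)               ≡⟨ cong ι (cycleWeight-toCycle p simple) ⟩
    ι (weight p)                    ∎
    where
    open ≤-Reasoning
    C = toCycle p simple

  a*ι≤ι-+ : ∀ {n₁ n₂ w₁ w₂} → a * ι n₁ ≤ ι w₁ → a * ι n₂ ≤ ι w₂ →
          a * ι (n₁ ℕ.+ n₂) ≤ ι (w₁ ℕ.+ w₂)
  a*ι≤ι-+ {n₁} {n₂} {w₁} {w₂} h₁ h₂ = subst₂ _≤_
    (sym (trans (cong (a *_) (ι-+ n₁ n₂)) (*-distribˡ-+ a (ι n₁) (ι n₂)))) (sym (ι-+ w₁ w₂))
    (+-mono-≤ h₁ h₂)

  -- A closed walk that is not simple splits into two shorter closed walks: a loop and the rest.
  weight-≥-fuel : ∀ fuel {n u} → n ℕ.< fuel → (p : Walk n u u) → a * ι n ≤ ι (weight p)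
  weight-≥-fuel (suc fuel) {n} n<fuel p with simple-or-loop p
  ... | inj₁ simple = simpleWalk-weight-≥ p simple
  ... | inj₂ (loopSplit {m₁ = m₁} {m₂} {m₃} p₁ loop p₃ len wt) =
    subst₂ (λ l w → a * ι l ≤ ι w) length≡ weight≡
      (a*ι≤ι-+ {m₁ ℕ.+ suc m₃} {suc m₂} {weight (p₁ ++ʷ p₃)} {weight loop}
        (weight-≥-fuel fuel (shorter rest≤) (p₁ ++ʷ p₃)) (weight-≥-fuel fuel (shorter loop≤) loop))
    where
    length≡ : m₁ ℕ.+ suc m₃ ℕ.+ suc m₂ ≡ n
    length≡ = trans (reorder m₁ m₂ m₃) len
      where
      reorder : ∀ x y z → x ℕ.+ suc z ℕ.+ suc y ≡ x ℕ.+ suc y ℕ.+ suc z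
      reorder = solve-∀
    weight≡ : weight (p₁ ++ʷ p₃) ℕ.+ weight loop ≡ weight p
    weight≡ = trans (cong (ℕ._+ weight loop) (weight-++ʷ p₁ p₃)) (trans (reorder (weight p₁) (weight loop) (weight p₃)) wt)
      where
      reorder : ∀ x y z → x ℕ.+ z ℕ.+ y ≡ x ℕ.+ y ℕ.+ z
      reorder = solve-∀
    shorter : ∀ {l} → suc l ℕ.≤ n → l ℕ.< fuel
    shorter sl≤n = ℕₚ.≤-trans sl≤n (ℕₚ.≤-pred n<fuel)
    rest≤ : suc (m₁ ℕ.+ suc m₃) ℕ.≤ n
    rest≤ = subst (_ ℕ.≤_) (trans (reorder m₁ m₂ m₃) len) (ℕₚ.m≤m+n _ m₂)
      where
      reorder : ∀ x y z → suc (x ℕ.+ suc z) ℕ.+ y ≡ x ℕ.+ suc y ℕ.+ suc z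
      reorder = solve-∀
    loop≤ : suc (suc m₂) ℕ.≤ n
    loop≤ = subst (_ ℕ.≤_) (trans (reorder m₁ m₂ m₃) len) (ℕₚ.m≤m+n _ (m₁ ℕ.+ m₃))
      where
      reorder : ∀ x y z → suc (suc y) ℕ.+ (x ℕ.+ z) ≡ x ℕ.+ suc y ℕ.+ suc z
      reorder = solve-∀

  closedWalk-weight-≥ : ∀ {n u} (p : Walk n u u) → a * ι n ≤ ι (weight p)
  closedWalk-weight-≥ {n} = weight-≥-fuel (suc n) ℕₚ.≤-refl

module CutIdentity (k M : ℕ) where

  open import Data.Nat
  open import Data.Nat.Properties
  open import Data.Nat.DivMod
  open import Data.Nat.Tactic.RingSolver using (solve-∀)
  open import Data.Bool.Properties using (xor-comm)
  open import Data.Fin.Properties using (toℕ<n)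
  open import Data.List using (List; map; allFin)
  open import Data.Nat.ListAction using (sum)
  open import Relation.Nullary.Reflects using (ofʸ; ofⁿ; det)
  open RangeSum
  open BitStrings

  n : ℕ
  n = suc k + M + k

  adjacentOffset : ℕ → Bool
  adjacentOffset d = (0 <ᵇ d) ∧ ((d ⊓ (n ∸ d)) ≤ᵇ k)

  <ᵇ-+ : ∀ i d → (i <ᵇ i + d) ≡ (0 <ᵇ d)
  <ᵇ-+ zero    d = refl
  <ᵇ-+ (suc i) d = <ᵇ-+ i d

  adjLt-+ : ∀ i d → adjLt n k i (i + d) ≡ adjacentOffset d
  adjLt-+ i d = cong₂ _∧_ (<ᵇ-+ i d) (cong (λ z → (z ⊓ (n ∸ z)) ≤ᵇ k) (m+n∸m≡n i d))

  adjLt-≥ : ∀ {i j} → j ≤ i → adjLt n k i j ≡ false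
  adjLt-≥ {i} {j} j≤i = cong (_∧ (((j ∸ i) ⊓ (n ∸ (j ∸ i))) ≤ᵇ k)) (det (<ᵇ-reflects-< i j) (ofⁿ (≤⇒≯ j≤i)))

  adjacentOffset-reflect : ∀ {d e} → 0 < d → 0 < e → d + e ≡ n → adjacentOffset d ≡ adjacentOffset e
  adjacentOffset-reflect {suc d} {suc e} _ _ d+e≡n =
    cong (_≤ᵇ k) (trans (cong (suc d ⊓_) (∸-from {suc d} d+e≡n))
                 (trans (⊓-comm (suc d) (suc e)) (cong (suc e ⊓_) (sym (∸-from {suc e} (trans (+-comm (suc e) (suc d)) d+e≡n))))))
    where
    ∸-from : ∀ {x y z} → x + y ≡ z → z ∸ x ≡ y
    ∸-from {x} {y} refl = m+n∸m≡n x y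

  adjacentOffset-near : ∀ d → d < k → adjacentOffset (suc d) ≡ true
  adjacentOffset-near d d<k = det (≤ᵇ-reflects-≤ _ k) (ofʸ (≤-trans (m⊓n≤m (suc d) (n ∸ suc d)) d<k))

  adjacentOffset-middle : ∀ d → d < M → adjacentOffset (suc k + d) ≡ false
  adjacentOffset-middle d d<M =
    det (≤ᵇ-reflects-≤ _ k) (ofⁿ (<⇒≱ (⊓-glb (s≤s (m≤m+n k d)) (m+n≤o⇒m≤o∸n (suc k) fits))))
    where
    fits : suc k + (suc k + d) ≤ n
    fits = subst (_≤ n) (reorder k d) (+-monoˡ-≤ k (+-monoʳ-≤ (suc k) d<M))
      where
      reorder : ∀ k d → suc k + suc d + k ≡ suc k + (suc k + d)
      reorder = solve-∀

  adjacentOffset-far : ∀ d → d < k → adjacentOffset (suc k + M + d) ≡ true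
  adjacentOffset-far d d<k = det (≤ᵇ-reflects-≤ _ k)
    (ofʸ (≤-trans (m⊓n≤n (suc k + M + d) _) (≤-trans (≤-reflexive n∸[N+d]≡k∸d) (m∸n≤m k d))))
    where
    n∸[N+d]≡k∸d : n ∸ (suc k + M + d) ≡ k ∸ d
    n∸[N+d]≡k∸d = trans (sym (∸-+-assoc n (suc k + M) d)) (cong (_∸ d) (m+n∸m≡n (suc k + M) k))

  ∑-adjacentOffset : ∀ (f : ℕ → Bool) →
    ∑[ j < n ] 𝟙 (adjacentOffset j ∧ f j) ≡ ∑[ d < k ] 𝟙 (f (suc d)) + ∑[ d < k ] 𝟙 (f (suc k + M + d))
  ∑-adjacentOffset f = begin
    ∑ n g                                                       ≡⟨ ∑-split (suc k + M) k g ⟩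
    ∑ (suc k + M) g + ∑[ d < k ] g (suc k + M + d)               ≡⟨ cong₂ _+_ (∑-split (suc k) M g) far ⟩
    (∑[ d < k ] g (suc d) + ∑[ d < M ] g (suc k + d)) + ∑[ d < k ] 𝟙 (f (suc k + M + d))
        ≡⟨ cong (_+ ∑[ d < k ] 𝟙 (f (suc k + M + d))) (trans (cong₂ _+_ near middle) (+-identityʳ _)) ⟩
    ∑[ d < k ] 𝟙 (f (suc d)) + ∑[ d < k ] 𝟙 (f (suc k + M + d)) ∎
    where
    open ≡-Reasoning
    g : ℕ → ℕ
    g j = 𝟙 (adjacentOffset j ∧ f j)
    near : ∑[ d < k ] g (suc d) ≡ ∑[ d < k ] 𝟙 (f (suc d))
    near = ∑-cong-< k (λ d d<k → cong (λ b → 𝟙 (b ∧ f (suc d))) (adjacentOffset-near d d<k))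
    middle : ∑[ d < M ] g (suc k + d) ≡ 0
    middle = trans (∑-cong-< M (λ d d<M → cong (λ b → 𝟙 (b ∧ f (suc k + d))) (adjacentOffset-middle d d<M)))
                   (trans (∑-const M 0) (*-zeroʳ M))
    far : ∑[ d < k ] g (suc k + M + d) ≡ ∑[ d < k ] 𝟙 (f (suc k + M + d))
    far = ∑-cong-< k (λ d d<k → cong (λ b → 𝟙 (b ∧ f (suc k + M + d))) (adjacentOffset-far d d<k))

  module Colouring (s : Vec Bool n) where

    colour : ℕ → Bool
    colour x = bitAt s (x % n)

    colour-periodic : ∀ x → colour (x + n) ≡ colour x
    colour-periodic x = cong (bitAt s) ([m+n]%n≡m%n x n)

    colour-shift : ∀ x y → colour (x + n + y) ≡ colour (x + y)
    colour-shift x y = trans (cong colour (reorder x n y)) (colour-periodic (x + y))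
      where
      reorder : ∀ x n y → x + n + y ≡ x + y + n
      reorder = solve-∀

    lookup≡colour : ∀ i → lookup s i ≡ colour (toℕ i)
    lookup≡colour i = trans (lookup≡bitAt s i) (cong (bitAt s) (sym (m<n⇒m%n≡m (toℕ<n i))))

    cut : ℕ → ℕ → ℕ
    cut i j = 𝟙 (adjLt n k i j ∧ (colour i xor colour j))

    pairCut : ℕ → ℕ → ℕ
    pairCut i j = cut i j + cut j i

    differ : ℕ → ℕ → ℕ
    differ i j = 𝟙 (colour i xor colour j)

    window : ℕ → Vec Bool (suc k)
    window i = tabulate (λ t → colour (i + toℕ t))

    cutSize≡∑∑cut : cutSize n k s ≡ ∑[ i < n ] ∑[ j < n ] cut i j
    cutSize≡∑∑cut = trans (sum-concatMap row (allFin n))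
                   (trans (sum-allFin n (sum ∘ row)) (sum-tabulate n (λ i → ∑ n (cut i)) sum-row))
      where
      cell : Fin n → Fin n → ℕ
      cell i j = 𝟙 (adjLt n k (toℕ i) (toℕ j) ∧ (lookup s i xor lookup s j))
      row : Fin n → List ℕ
      row i = map (cell i) (allFin n)
      sum-row : ∀ i → sum (row i) ≡ ∑ n (cut (toℕ i))
      sum-row i = trans (sum-allFin n (cell i)) (sum-tabulate n (cut (toℕ i)) λ j →
        cong₂ (λ b c → 𝟙 (adjLt n k (toℕ i) (toℕ j) ∧ (b xor c))) (lookup≡colour i) (lookup≡colour j))

    pairCut-+ : ∀ i d → pairCut i (i + d) ≡ 𝟙 (adjacentOffset d ∧ (colour i xor colour (i + d)))
    pairCut-+ i d = trans (cong₂ _+_ (cong (λ b → 𝟙 (b ∧ (colour i xor colour (i + d)))) (adjLt-+ i d))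
                                     (cong (λ b → 𝟙 (b ∧ (colour (i + d) xor colour i))) (adjLt-≥ (m≤m+n i d))))
                          (+-identityʳ _)

    pairCut-wrap : ∀ {i j j′ e} → 0 < e → 0 < j → j′ + e ≡ i → e + j ≡ n →
      pairCut i j′ ≡ 𝟙 (adjacentOffset j ∧ (colour i xor colour (i + j)))
    pairCut-wrap {j = j} {j′} {e} 0<e 0<j refl e+j≡n = begin
      pairCut (j′ + e) j′
        ≡⟨ +-comm (cut (j′ + e) j′) (cut j′ (j′ + e)) ⟩
      pairCut j′ (j′ + e)
        ≡⟨ pairCut-+ j′ e ⟩
      𝟙 (adjacentOffset e ∧ (colour j′ xor colour (j′ + e)))
        ≡⟨ cong₂ (λ b c → 𝟙 (b ∧ (c xor colour (j′ + e)))) (adjacentOffset-reflect 0<e 0<j e+j≡n) colour-j′ ⟩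
      𝟙 (adjacentOffset j ∧ (colour (j′ + e + j) xor colour (j′ + e)))
        ≡⟨ cong (λ b → 𝟙 (adjacentOffset j ∧ b)) (xor-comm (colour (j′ + e + j)) (colour (j′ + e))) ⟩
      𝟙 (adjacentOffset j ∧ (colour (j′ + e) xor colour (j′ + e + j)))
        ∎
      where
      open ≡-Reasoning
      colour-j′ : colour j′ ≡ colour (j′ + e + j)
      colour-j′ = sym (trans (cong colour (trans (+-assoc j′ e j) (cong (j′ +_) e+j≡n))) (colour-periodic j′))

    pairCut-rotated : ∀ {i j} → i < n → j < n →
      pairCut i ((i + j) % n) ≡ 𝟙 (adjacentOffset j ∧ (colour i xor colour (i + j)))
    pairCut-rotated {i} {j} i<n j<n with i + j <? n
    ... | yes i+j<n = trans (cong (pairCut i) (m<n⇒m%n≡m i+j<n)) (pairCut-+ i j)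
    ... | no  i+j≮n = trans (cong (pairCut i) [i+j]%n≡j′) (pairCut-wrap 0<e 0<j j′+e≡i e+j≡n)
      where
      n≤i+j : n ≤ i + j
      n≤i+j = ≮⇒≥ i+j≮n
      j′ : ℕ
      j′ = i + j ∸ n
      i+j≡j′+n : i + j ≡ j′ + n
      i+j≡j′+n = sym (m∸n+n≡m n≤i+j)
      j′<i : j′ < i
      j′<i = +-cancelʳ-< n j′ i (subst (_< i + n) i+j≡j′+n (+-monoʳ-< i j<n))
      e : ℕ
      e = proj₁ (m≤n⇒∃[o]m+o≡n (<⇒≤ j′<i))
      j′+e≡i : j′ + e ≡ i
      j′+e≡i = proj₂ (m≤n⇒∃[o]m+o≡n (<⇒≤ j′<i))
      e+j≡n : e + j ≡ n
      e+j≡n = +-cancelˡ-≡ j′ _ _ (trans (sym (+-assoc j′ e j)) (trans (cong (_+ j) j′+e≡i) i+j≡j′+n))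
      0<e : 0 < e
      0<e = +-cancelˡ-< j′ 0 e (subst₂ _<_ (sym (+-identityʳ j′)) (sym j′+e≡i) j′<i)
      0<j : 0 < j
      0<j = +-cancelˡ-< i 0 j (subst (_< i + j) (sym (+-identityʳ i)) (<-≤-trans i<n n≤i+j))
      [i+j]%n≡j′ : (i + j) % n ≡ j′
      [i+j]%n≡j′ = trans (cong (_% n) i+j≡j′+n) (trans ([m+n]%n≡m%n j′ n) (m<n⇒m%n≡m (<-trans j′<i i<n)))

    forwardCut backwardCut : ℕ → ℕ
    forwardCut  i = ∑[ d < k ] differ i (i + suc d)
    backwardCut i = ∑[ d < k ] differ i (i + (suc k + M + d))

    ∑-pairCut : ∀ {i} → i < n → ∑[ j < n ] pairCut i j ≡ forwardCut i + backwardCut i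
    ∑-pairCut {i} i<n = begin
      ∑[ j < n ] pairCut i j
        ≡⟨ ∑-cong-< n (λ j j<n → cong (pairCut i) (sym (m<n⇒m%n≡m j<n))) ⟩
      ∑[ j < n ] pairCut i (j % n)
        ≡⟨ sym (∑-rotate n (λ x → cong (pairCut i) ([m+n]%n≡m%n x n)) i) ⟩
      ∑[ j < n ] pairCut i ((i + j) % n)
        ≡⟨ ∑-cong-< n (λ j j<n → pairCut-rotated i<n j<n) ⟩
      ∑[ j < n ] 𝟙 (adjacentOffset j ∧ (colour i xor colour (i + j)))
        ≡⟨ ∑-adjacentOffset (λ j → colour i xor colour (i + j)) ⟩
      forwardCut i + backwardCut i
        ∎
      where open ≡-Reasoning

    -- The backward offsets suc k + M + d are the forward offsets k ∸ d taken around the cycle.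
    ∑backwardCut≡∑forwardCut : ∑ n backwardCut ≡ ∑ n forwardCut
    ∑backwardCut≡∑forwardCut = begin
      ∑[ i < n ] ∑[ d < k ] differ i (i + (suc k + M + d))
        ≡⟨ ∑-comm n k (λ i d → differ i (i + (suc k + M + d))) ⟩
      ∑[ d < k ] ∑[ i < n ] differ i (i + (suc k + M + d))
        ≡⟨ ∑-cong-< k backward≡forward ⟩
      ∑[ d < k ] ∑[ i < n ] differ i (i + suc (k ∸ suc d))
        ≡⟨ ∑-reverse k (λ d → ∑[ i < n ] differ i (i + suc d)) ⟩
      ∑[ d < k ] ∑[ i < n ] differ i (i + suc d)
        ≡⟨ sym (∑-comm n k (λ i d → differ i (i + suc d))) ⟩
      ∑[ i < n ] ∑[ d < k ] differ i (i + suc d)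
        ∎
      where
      open ≡-Reasoning
      backward≡forward : ∀ d → d < k →
        ∑[ i < n ] differ i (i + (suc k + M + d)) ≡ ∑[ i < n ] differ i (i + suc (k ∸ suc d))
      backward≡forward d d<k = begin
        ∑[ i < n ] differ i (i + (suc k + M + d))          ≡⟨ sym (∑-rotate n periodic c) ⟩
        ∑[ i < n ] differ (c + i) (c + i + (suc k + M + d)) ≡⟨ ∑-cong n (λ i → cong (differ (c + i)) (wraps i)) ⟩
        ∑[ i < n ] differ (c + i) (i + n)                  ≡⟨ ∑-cong n swap ⟩
        ∑[ i < n ] differ i (i + c)                        ∎
        where
        c : ℕ
        c = suc (k ∸ suc d)
        periodic : ∀ x → differ (x + n) (x + n + (suc k + M + d)) ≡ differ x (x + (suc k + M + d))
        periodic x = cong₂ (λ b c → 𝟙 (b xor c)) (colour-periodic x) (colour-shift x (suc k + M + d))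
        wraps : ∀ i → c + i + (suc k + M + d) ≡ i + n
        wraps i = trans (reorder (k ∸ suc d) i k M d) (cong (λ x → i + (suc k + M + x)) (m+[n∸m]≡n d<k))
          where
          reorder : ∀ x i k M d → suc x + i + (suc k + M + d) ≡ i + (suc k + M + (suc d + x))
          reorder = solve-∀
        swap : ∀ i → differ (c + i) (i + n) ≡ differ i (i + c)
        swap i = trans (cong (λ b → 𝟙 (colour (c + i) xor b)) (colour-periodic i))
                 (trans (cong 𝟙 (xor-comm (colour (c + i)) (colour i))) (cong (differ i) (+-comm c i)))

    arcWeight-window : ∀ i → arcWeight (window i) + forwardCut i ≡ k
    arcWeight-window i = trans
      (cong (λ b → countEq b (tabulate {n = k} (λ t → colour (i + suc (toℕ t)))) + forwardCut i)
            (cong colour (+-identityʳ i)))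
      (countEq+mismatches≡length k (λ d → colour (i + suc d)) (colour i))

    cutSize≡∑forwardCut : cutSize n k s ≡ ∑ n forwardCut
    cutSize≡∑forwardCut = *-cancelˡ-≡ (cutSize n k s) (∑ n forwardCut) 2
      (trans (cong (cutSize n k s +_) (+-identityʳ _)) (trans twice (cong (∑ n forwardCut +_) (sym (+-identityʳ _)))))
      where
      open ≡-Reasoning
      -- Each edge is counted once by cut, and once from each of its ends by pairCut.
      twice : cutSize n k s + cutSize n k s ≡ ∑ n forwardCut + ∑ n forwardCut
      twice = begin
        cutSize n k s + cutSize n k s
          ≡⟨ cong₂ _+_ cutSize≡∑∑cut (trans cutSize≡∑∑cut (∑-comm n n cut)) ⟩
        ∑[ i < n ] ∑[ j < n ] cut i j + ∑[ i < n ] ∑[ j < n ] cut j i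
          ≡⟨ sym (∑-distrib-+ n (λ i → ∑ n (cut i)) (λ i → ∑[ j < n ] cut j i)) ⟩
        ∑[ i < n ] (∑[ j < n ] cut i j + ∑[ j < n ] cut j i)
          ≡⟨ ∑-cong n (λ i → sym (∑-distrib-+ n (cut i) (λ j → cut j i))) ⟩
        ∑[ i < n ] ∑[ j < n ] pairCut i j
          ≡⟨ ∑-cong-< n (λ i i<n → ∑-pairCut i<n) ⟩
        ∑[ i < n ] (forwardCut i + backwardCut i)
          ≡⟨ ∑-distrib-+ n forwardCut backwardCut ⟩
        ∑ n forwardCut + ∑ n backwardCut
          ≡⟨ cong (∑ n forwardCut +_) ∑backwardCut≡∑forwardCut ⟩
        ∑ n forwardCut + ∑ n forwardCut
          ∎

    cutSize+∑arcWeight≡n*k : cutSize n k s + ∑[ i < n ] arcWeight (window i) ≡ n * k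
    cutSize+∑arcWeight≡n*k = begin
      cutSize n k s + ∑[ i < n ] arcWeight (window i)
        ≡⟨ cong (_+ ∑[ i < n ] arcWeight (window i)) cutSize≡∑forwardCut ⟩
      ∑ n forwardCut + ∑[ i < n ] arcWeight (window i)
        ≡⟨ sym (∑-distrib-+ n forwardCut (arcWeight ∘ window)) ⟩
      ∑[ i < n ] (forwardCut i + arcWeight (window i))
        ≡⟨ ∑-cong n (λ i → trans (+-comm (forwardCut i) _) (arcWeight-window i)) ⟩
      ∑[ i < n ] k
        ≡⟨ ∑-const n k ⟩
      n * k
        ∎
      where open ≡-Reasoning

module WindowWalk (k M : ℕ) (s : Vec Bool (CutIdentity.n k M)) where

  open import Data.Nat
  open import Data.Nat.Properties
  open import Data.Fin.Properties using (toℕ-inject₁)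
  open import Data.Vec.Properties using (tabulate-cong)
  open RangeSum
  open BitStrings using (init-tabulate)
  open CutIdentity k M using (n; module Colouring)
  open Colouring s
  open DeBruijnWalks k

  init-window-suc : ∀ i → init (window (suc i)) ≡ tail (window i)
  init-window-suc i = trans (init-tabulate k (λ t → colour (suc i + toℕ t)))
    (tabulate-cong (λ t → cong colour (trans (cong (suc i +_) (toℕ-inject₁ t)) (sym (+-suc i (toℕ t))))))

  windowWalk : ∀ m i {u v} → init (window i) ≡ u → init (window (i + m)) ≡ v → Walk m u v
  windowWalk zero    i eu ev = stay (trans (sym eu) (trans (cong (init ∘ window) (sym (+-identityʳ i))) ev))
  windowWalk (suc m) i eu ev =
    cons (window i) eu (windowWalk m (suc i) (init-window-suc i) (trans (cong (init ∘ window) (sym (+-suc i m))) ev))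

  weight-windowWalk : ∀ m i {u v} (eu : init (window i) ≡ u) (ev : init (window (i + m)) ≡ v) →
    weight (windowWalk m i eu ev) ≡ ∑[ j < m ] arcWeight (window (i + j))
  weight-windowWalk zero    i eu ev = weight-stay (trans (sym eu) (trans (cong (init ∘ window) (sym (+-identityʳ i))) ev))
  weight-windowWalk (suc m) i eu ev = cong₂ _+_ (cong (arcWeight ∘ window) (sym (+-identityʳ i)))
    (trans (weight-windowWalk m (suc i) (init-window-suc i) _) (∑-cong m (λ j → cong (arcWeight ∘ window) (sym (+-suc i j)))))

  window-periodic : window n ≡ window 0
  window-periodic = tabulate-cong (λ t → trans (cong colour (+-comm n (toℕ t))) (colour-periodic (toℕ t)))

  closedWindowWalk : Walk n (init (window 0)) (init (window 0))
  closedWindowWalk = windowWalk n 0 refl (cong init window-periodic)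

  weight-closedWindowWalk : weight closedWindowWalk ≡ ∑[ i < n ] arcWeight (window i)
  weight-closedWindowWalk = weight-windowWalk n 0 refl (cong init window-periodic)

module CycleUnrolling (k : ℕ) (C : Cycle k) where

  open import Data.Nat
  open import Data.Nat.Properties
  open import Data.Nat.DivMod
  open import Data.Fin.Properties using (toℕ-inject₁; toℕ-injective; toℕ-fromℕ; toℕ-fromℕ<; toℕ<n)
  open import Data.Nat.Tactic.RingSolver using (solve-∀)
  open RangeSum
  open BitStrings
  open Cycle C using (m; arcs; linked; closed)

  L : ℕ
  L = suc m

  position : ℕ → Fin L
  position x = fromℕ< (m%n<n x L)

  arcAt : ℕ → Vec Bool (suc k)
  arcAt = arcs ∘ position

  label : ℕ → Bool
  label x = bitAt (arcAt x) 0

  weightAt : ℕ → ℕ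
  weightAt = arcWeight ∘ arcAt

  position-toℕ : ∀ i → position (toℕ i) ≡ i
  position-toℕ i = toℕ-injective (trans (toℕ-fromℕ< (m%n<n (toℕ i) L)) (m<n⇒m%n≡m (toℕ<n i)))

  position-suc : ∀ j → toℕ (position (suc j)) ≡ suc (j % L) % L
  position-suc j = trans (toℕ-fromℕ< (m%n<n (suc j) L))
    (trans (cong (λ z → suc z % L) (m≡m%n+[m/n]*n j L)) ([m+kn]%n≡m%n (suc (j % L)) (j / L) L))

  tail-arcAt : ∀ j → tail (arcAt j) ≡ init (arcAt (suc j))
  tail-arcAt j with m≤n⇒m<n∨m≡n (≤-pred (m%n<n j L))
  ... | inj₁ j%L<m = subst₂ (λ x y → tail (arcs x) ≡ init (arcs y)) here next (linked i)
    where
    i : Fin m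
    i = fromℕ< j%L<m
    here : inject₁ i ≡ position j
    here = toℕ-injective (trans (toℕ-inject₁ i) (trans (toℕ-fromℕ< j%L<m) (sym (toℕ-fromℕ< (m%n<n j L)))))
    next : fsuc i ≡ position (suc j)
    next = toℕ-injective (sym (trans (position-suc j) (trans (m<n⇒m%n≡m (s≤s j%L<m)) (cong suc (sym (toℕ-fromℕ< j%L<m))))))
  ... | inj₂ j%L≡m = subst₂ (λ x y → tail (arcs x) ≡ init (arcs y)) here next closed
    where
    here : fromℕ m ≡ position j
    here = toℕ-injective (trans (toℕ-fromℕ m) (sym (trans (toℕ-fromℕ< (m%n<n j L)) j%L≡m)))
    next : fzero ≡ position (suc j)
    next = toℕ-injective (sym (trans (position-suc j) (trans (cong (λ z → suc z % L) j%L≡m) (n%n≡0 L))))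

  bitAt-arcAt : ∀ t → t ≤ k → ∀ j → bitAt (arcAt j) t ≡ label (j + t)
  bitAt-arcAt zero    _    j = cong label (sym (+-identityʳ j))
  bitAt-arcAt (suc t) t<k j = begin
    bitAt (arcAt j) (suc t)        ≡⟨ bitAt-tail (arcAt j) t ⟩
    bitAt (tail (arcAt j)) t       ≡⟨ cong (λ v → bitAt v t) (tail-arcAt j) ⟩
    bitAt (init (arcAt (suc j))) t ≡⟨ bitAt-init (arcAt (suc j)) t t<k ⟩
    bitAt (arcAt (suc j)) t        ≡⟨ bitAt-arcAt t (<⇒≤ t<k) (suc j) ⟩
    label (suc j + t)              ≡⟨ cong label (sym (+-suc j t)) ⟩
    label (j + suc t)              ∎
    where open ≡-Reasoning

  arcAt≡tabulate : ∀ j → arcAt j ≡ tabulate (λ t → label (j + toℕ t))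
  arcAt≡tabulate j = bitAt-injective _ _ (λ t t<k+1 →
    trans (bitAt-arcAt t (≤-pred t<k+1) j) (sym (bitAt-tabulate (λ x → label (j + x)) t t<k+1)))

  weightAt-periodic : ∀ x → weightAt (x + L) ≡ weightAt x
  weightAt-periodic x = cong (arcWeight ∘ arcs) (toℕ-injective
    (trans (toℕ-fromℕ< (m%n<n (x + L) L)) (trans ([m+n]%n≡m%n x L) (sym (toℕ-fromℕ< (m%n<n x L))))))

  ∑-weightAt-period : ∑ L weightAt ≡ cycleWeight C
  ∑-weightAt-period = sym (trans (sum-allFin L (arcWeight ∘ arcs))
    (sum-tabulate L weightAt (λ i → cong (arcWeight ∘ arcs) (sym (position-toℕ i)))))

  ∑-weightAt-≤ : ∀ y → L * ∑ y weightAt ≤ y * cycleWeight C + L * cycleWeight C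
  ∑-weightAt-≤ y = begin
    L * ∑ y weightAt                             ≡⟨ cong (λ z → L * ∑ z weightAt) y≡qL+r ⟩
    L * ∑ (q * L + r) weightAt                   ≡⟨ cong (L *_) (∑-split (q * L) r weightAt) ⟩
    L * (∑ (q * L) weightAt + ∑[ d < r ] weightAt (q * L + d))
        ≡⟨ cong (λ z → L * z) (cong₂ _+_ (∑-repeat L weightAt-periodic q)
                                         (∑-cong r (periodic-* L weightAt-periodic q))) ⟩
    L * (q * ∑ L weightAt + ∑ r weightAt)        ≤⟨ *-monoʳ-≤ L (+-monoʳ-≤ (q * ∑ L weightAt) partial) ⟩
    L * (q * ∑ L weightAt + ∑ L weightAt)        ≡⟨ cong (λ z → L * (q * z + z)) ∑-weightAt-period ⟩
    L * (q * W + W)                              ≡⟨ reorder L q W ⟩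
    q * L * W + L * W                            ≤⟨ +-monoˡ-≤ (L * W) (*-monoˡ-≤ W (m/n*n≤m y L)) ⟩
    y * W + L * W                                ∎
    where
    open ≤-Reasoning
    W = cycleWeight C
    q = y / L
    r = y % L
    y≡qL+r : y ≡ q * L + r
    y≡qL+r = trans (m≡m%n+[m/n]*n y L) (+-comm r (q * L))
    partial : ∑ r weightAt ≤ ∑ L weightAt
    partial = subst (λ z → ∑ r weightAt ≤ ∑ z weightAt) (m+[n∸m]≡n (<⇒≤ (m%n<n y L))) (∑-≤-∑-+ r (L ∸ r) weightAt)
    reorder : ∀ L q W → L * (q * W + W) ≡ q * L * W + L * W
    reorder = solve-∀

module UnrolledColouring (k M : ℕ) (C : Cycle k) where

  open import Data.Nat
  open import Data.Nat.Properties
  open import Data.Nat.DivMod using (m<n⇒m%n≡m)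
  open import Data.Nat.Tactic.RingSolver using (solve-∀)
  open import Data.Fin.Properties using (toℕ<n)
  open import Data.Vec.Properties using (tabulate-cong)
  open RangeSum
  open BitStrings
  open CycleUnrolling k C
  open CutIdentity k M using (n; module Colouring)

  unrolled : Vec Bool n
  unrolled = tabulate (label ∘ toℕ)

  open Colouring unrolled

  colour-unrolled : ∀ y → y < n → colour y ≡ label y
  colour-unrolled y y<n = trans (cong (bitAt unrolled) (m<n⇒m%n≡m y<n)) (bitAt-tabulate label y y<n)

  window≡arcAt : ∀ j → j < suc k + M → window j ≡ arcAt j
  window≡arcAt j j<N = trans (tabulate-cong (λ t → colour-unrolled (j + toℕ t) (inside t))) (sym (arcAt≡tabulate j))
    where
    inside : ∀ t → j + toℕ t < n
    inside t = <-≤-trans (+-monoʳ-< j (toℕ<n t)) (≤-trans (≤-reflexive (+-suc j k)) (+-monoˡ-≤ k j<N))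

  -- Only the last k windows wrap around, and each arc has weight at most k.
  ∑arcWeight-window-≤ : ∑[ i < n ] arcWeight (window i) ≤ ∑ n weightAt + k * k
  ∑arcWeight-window-≤ = begin
    ∑[ i < n ] arcWeight (window i)
      ≡⟨ ∑-split (suc k + M) k (arcWeight ∘ window) ⟩
    ∑[ i < suc k + M ] arcWeight (window i) + ∑[ d < k ] arcWeight (window (suc k + M + d))
      ≤⟨ +-mono-≤ (≤-trans (≤-reflexive unwrapped) (∑-≤-∑-+ (suc k + M) k weightAt))
                  (∑-≤-const k k (λ d _ → arcWeight-≤ (window (suc k + M + d)))) ⟩
    ∑ n weightAt + k * k
      ∎
    where
    open ≤-Reasoning
    unwrapped : ∑[ i < suc k + M ] arcWeight (window i) ≡ ∑ (suc k + M) weightAt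
    unwrapped = ∑-cong-< (suc k + M) (λ j j<N → cong arcWeight (window≡arcAt j j<N))

  L*∑arcWeight-window-≤ : L * ∑[ i < n ] arcWeight (window i) ≤ n * cycleWeight C + L * (cycleWeight C + k * k)
  L*∑arcWeight-window-≤ = begin
    L * ∑[ i < n ] arcWeight (window i)                  ≤⟨ *-monoʳ-≤ L ∑arcWeight-window-≤ ⟩
    L * (∑ n weightAt + k * k)                           ≡⟨ *-distribˡ-+ L (∑ n weightAt) (k * k) ⟩
    L * ∑ n weightAt + L * (k * k)                       ≤⟨ +-monoˡ-≤ (L * (k * k)) (∑-weightAt-≤ n) ⟩
    n * cycleWeight C + L * cycleWeight C + L * (k * k)  ≡⟨ reorder n (cycleWeight C) L (k * k) ⟩
    n * cycleWeight C + L * (cycleWeight C + k * k)      ∎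
    where
    open ≤-Reasoning
    reorder : ∀ n W L e → n * W + L * W + L * e ≡ n * W + L * (W + e)
    reorder = solve-∀

module MaxCut where

  open import Data.Nat
  open import Data.Nat.Properties
  open import Data.List using (List; []; _∷_; foldr; map; concatMap)
  open import Data.List.Membership.Propositional using (_∈_)
  open import Data.List.Membership.Propositional.Properties using (∈-++⁺ʳ)
  open import Data.List.Relation.Unary.Any using (here; there)

  foldr-⊔-upper : ∀ {A : Set} (f : A → ℕ) {x} xs → x ∈ xs → f x ≤ foldr _⊔_ 0 (map f xs)
  foldr-⊔-upper f (y ∷ xs) (here refl) = m≤m⊔n (f y) _
  foldr-⊔-upper f (y ∷ xs) (there x∈xs) = ≤-trans (foldr-⊔-upper f xs x∈xs) (m≤n⊔m (f y) _)

  foldr-⊔-attained : ∀ {A : Set} (f : A → ℕ) x xs → ∃ λ y → foldr _⊔_ 0 (map f (x ∷ xs)) ≡ f y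
  foldr-⊔-attained f x [] = x , ⊔-identityʳ (f x)
  foldr-⊔-attained f x (x′ ∷ xs) with ⊔-sel (f x) (foldr _⊔_ 0 (map f (x′ ∷ xs)))
  ... | inj₁ max≡fx   = x , max≡fx
  ... | inj₂ max≡rest = let (y , rest≡fy) = foldr-⊔-attained f x′ xs in y , trans max≡rest rest≡fy

  ∈-allBool : ∀ n (s : Vec Bool n) → s ∈ allBool n
  ∈-allBool zero    []      = here refl
  ∈-allBool (suc n) (b ∷ s) = extend b (allBool n) (∈-allBool n s)
    where
    extend : ∀ b ss → s ∈ ss → (b ∷ s) ∈ concatMap (λ v → (false ∷ v) ∷ (true ∷ v) ∷ []) ss
    extend false (s′ ∷ ss) (here refl)  = here refl
    extend true  (s′ ∷ ss) (here refl)  = there (here refl)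
    extend b     (s′ ∷ ss) (there s∈ss) = ∈-++⁺ʳ ((false ∷ s′) ∷ (true ∷ s′) ∷ []) (extend b ss s∈ss)

  allBool-nonEmpty : ∀ n → ∃₂ λ s ss → allBool n ≡ s ∷ ss
  allBool-nonEmpty zero = [] , [] , refl
  allBool-nonEmpty (suc n) with allBool n | allBool-nonEmpty n
  ... | _ | s , ss , refl = false ∷ s , _ , refl

  cutSize≤mc : ∀ n k s → cutSize n k s ≤ mc n k
  cutSize≤mc n k s = foldr-⊔-upper (cutSize n k) (allBool n) (∈-allBool n s)

  mc-attained : ∀ n k → ∃ λ s → mc n k ≡ cutSize n k s
  mc-attained n k with allBool n | allBool-nonEmpty n
  ... | _ | s , ss , refl = foldr-⊔-attained (cutSize n k) s ss

module MaxCutBounds (k : ℕ) (a : ℚ) (isA : IsA k a) where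

  open import Data.Nat as ℕ using (z≤n; s≤s)
  open import Data.Integer using (+_)
  open import Data.Rational
  open import Data.Rational.Properties
  open import Data.Rational.Solver using (module +-*-Solver)
  open RangeSum using (∑)
  open Rationals
  open ClosedWalkBound k a isA
  open MaxCut

  optimalCycle : Cycle k
  optimalCycle = proj₁ (proj₁ isA)

  errorTerm : ℕ
  errorTerm = cycleWeight optimalCycle ℕ.+ k ℕ.* k

  module _ (M : ℕ) where

    open CutIdentity k M using (n; module Colouring)

    mc-≤ : ι (mc n k) ≤ ι n * (ι k - a)
    mc-≤ with mc-attained n k
    ... | s , mc≡cut = subst (λ c → ι c ≤ ι n * (ι k - a)) (sym mc≡cut) (p+q≡r*s⇒p≤r*[s-a] a sum≡ walk≥)
      where
      open Colouring s
      open WindowWalk k M s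
      sum≡ : ι (cutSize n k s) + ι (∑[ i < n ] arcWeight (window i)) ≡ ι n * ι k
      sum≡ = trans (sym (ι-+ (cutSize n k s) _)) (trans (cong ι cutSize+∑arcWeight≡n*k) (ι-* n k))
      walk≥ : a * ι n ≤ ι (∑[ i < n ] arcWeight (window i))
      walk≥ = subst (λ w → a * ι n ≤ ι w) weight-closedWindowWalk (closedWalk-weight-≥ closedWindowWalk)

    mc-≥ : ι n * (ι k - a) ≤ ι (mc n k) + ι errorTerm
    mc-≥ = begin
      ι n * (ι k - a)                        ≤⟨ p+q≡r*s⇒r*[s-a]≤p+e {ι (cutSize n k unrolled)} {ι T} {ι n} {ι k}
                                                                    a (ι errorTerm) sum≡ unrolled≤ ⟩
      ι (cutSize n k unrolled) + ι errorTerm ≤⟨ +-monoˡ-≤ (ι errorTerm) (ι-mono-≤ (cutSize≤mc n k unrolled)) ⟩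
      ι (mc n k) + ι errorTerm               ∎
      where
      open ≤-Reasoning
      open CycleUnrolling k optimalCycle using (L)
      open UnrolledColouring k M optimalCycle
      open Colouring unrolled
      open +-*-Solver
      W = cycleWeight optimalCycle
      T = ∑[ i < n ] arcWeight (window i)
      sum≡ : ι (cutSize n k unrolled) + ι T ≡ ι n * ι k
      sum≡ = trans (sym (ι-+ (cutSize n k unrolled) T)) (trans (cong ι cutSize+∑arcWeight≡n*k) (ι-* n k))
      L*a≡W : ι L * a ≡ ι W
      L*a≡W = trans (cong (ι L *_) (sym (proj₂ (proj₁ isA)))) (ι-*-/-cancel (+ W) (Cycle.m optimalCycle))
      unrolled≤ : ι T ≤ ι n * a + ι errorTerm
      unrolled≤ = *-cancelˡ-≤-pos (ι L) {{positive (ι-mono-< {0} {L} (s≤s z≤n))}} (begin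
        ι L * ι T                           ≡⟨ sym (ι-* L T) ⟩
        ι (L ℕ.* T)                         ≤⟨ ι-mono-≤ L*∑arcWeight-window-≤ ⟩
        ι (n ℕ.* W ℕ.+ L ℕ.* errorTerm)     ≡⟨ trans (ι-+ (n ℕ.* W) (L ℕ.* errorTerm))
                                                      (cong₂ _+_ (ι-* n W) (ι-* L errorTerm)) ⟩
        ι n * ι W + ι L * ι errorTerm       ≡⟨ cong (λ w → ι n * w + ι L * ι errorTerm) (sym L*a≡W) ⟩
        ι n * (ι L * a) + ι L * ι errorTerm ≡⟨ solve 4 (λ N L a E → N :* (L :* a) :+ L :* E := L :* (N :* a :+ E))
                                                       refl (ι n) (ι L) a (ι errorTerm) ⟩
        ι L * (ι n * a + ι errorTerm)       ∎)

    mc-close : ∣ ι (mc n k) - ι n * (ι k - a) ∣ ≤ ι errorTerm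
    mc-close = p≤q≤p+e⇒∣p-q∣≤e mc-≤ mc-≥

module AlternatingCycle (k : ℕ) where

  open import Data.Nat as ℕ using (s≤s)
  import Data.Nat.Properties as ℕₚ
  open import Data.Nat.Tactic.RingSolver using (solve-∀)
  open import Data.Integer using (+_)
  open import Data.Rational
  open import Data.Rational.Properties
  open BitStrings using (countEq-≤)
  open Rationals

  alternating : Bool → (m : ℕ) → Vec Bool m
  alternating b zero    = []
  alternating b (suc m) = b ∷ alternating (not b) m

  init-alternating : ∀ b m → init (alternating b (suc m)) ≡ alternating b m
  init-alternating b zero    = refl
  init-alternating b (suc m) = cong (b ∷_) (init-alternating (not b) m)

  alternatingCycle : Cycle (suc k)
  alternatingCycle = record
    { m      = 1
    ; arcs   = arcs
    ; linked = λ { fzero → sym (init-alternating true (suc k)) }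
    ; closed = sym (init-alternating false (suc k))
    ; simple = simple
    }
    where
    arcs : Fin 2 → Vec Bool (suc (suc k))
    arcs fzero    = alternating false (suc (suc k))
    arcs (fsuc _) = alternating true (suc (suc k))
    simple : ∀ {i j} → init (arcs i) ≡ init (arcs j) → i ≡ j
    simple {fzero}      {fzero}      _ = refl
    simple {fsuc fzero} {fsuc fzero} _ = refl
    simple {fzero}      {fsuc fzero} h
      with trans (sym (init-alternating false (suc k))) (trans h (init-alternating true (suc k)))
    ... | ()
    simple {fsuc fzero} {fzero}      h
      with trans (sym (init-alternating true (suc k))) (trans h (init-alternating false (suc k)))
    ... | ()

  -- Consecutive bits of an alternating arc differ, so its weight is at most k.
  cycleWeight-alternating : cycleWeight alternatingCycle ℕ.≤ k ℕ.+ k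
  cycleWeight-alternating = ℕₚ.+-mono-≤ (countEq-≤ false (alternating false k))
    (ℕₚ.≤-trans (ℕₚ.≤-reflexive (ℕₚ.+-identityʳ _)) (countEq-≤ true (alternating true k)))

  a<k : ∀ {a} → IsA (suc k) a → a < ι (suc k)
  a<k isA = ≤-<-trans (proj₂ isA alternatingCycle) (*-cancelˡ-<-nonNeg (ι 2) {{ι-nonNeg 2}} (begin-strict
    ι 2 * cycleRatio alternatingCycle ≡⟨ ι-*-/-cancel (+ W) 1 ⟩
    ι W                               <⟨ ι-mono-< (ℕₚ.≤-trans (s≤s cycleWeight-alternating)
                                                   (ℕₚ.≤-trans (ℕₚ.n≤1+n _) (ℕₚ.≤-reflexive (double k)))) ⟩
    ι (2 ℕ.* suc k)                   ≡⟨ ι-* 2 (suc k) ⟩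
    ι 2 * ι (suc k)                   ∎))
    where
    open ≤-Reasoning
    W = cycleWeight alternatingCycle
    double : ∀ k → suc (suc (k ℕ.+ k)) ≡ 2 ℕ.* suc k
    double = solve-∀

  k-a-positive : ∀ {a} → IsA (suc k) a → Positive (ι (suc k) - a)
  k-a-positive {a} isA = positive (subst (_< ι (suc k) - a) (+-inverseʳ a) (+-monoˡ-< (- a) (a<k isA)))

open import Data.Nat using (ℕ; _≥_; _<_)
open import Data.Integer using (+_)
open import Data.Rational using (ℚ; _/_; _≤_; _<_; _-_; _*_; ∣_∣; 0ℚ)
open import Data.Product using (∃)
import Data.Nat as ℕ
import Data.Nat.Properties as ℕₚ
open import Data.Nat.Tactic.RingSolver using (solve-∀)
open import Data.Rational using (Positive; positive)
import Data.Rational.Properties as ℚₚ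

≥2k+1⇒≡k+1+M+k : ∀ k {n} → suc (k ℕ.+ k) ℕ.≤ n → ∃ λ M → suc k ℕ.+ M ℕ.+ k ≡ n
≥2k+1⇒≡k+1+M+k k {n} 2k+1≤n = M , trans (reorder k M) 2k+1+M≡n
  where
  M = proj₁ (ℕₚ.m≤n⇒∃[o]m+o≡n 2k+1≤n)
  2k+1+M≡n = proj₂ (ℕₚ.m≤n⇒∃[o]m+o≡n 2k+1≤n)
  reorder : ∀ k M → suc k ℕ.+ M ℕ.+ k ≡ suc (k ℕ.+ k) ℕ.+ M
  reorder = solve-∀

corollary1 : (k : ℕ) → 0 Data.Nat.< k → (a : ℚ) → IsA k a →
    (ε : ℚ) → 0ℚ Data.Rational.< ε →
    ∃ λ (N : ℕ) → (n : ℕ) → n ≥ N →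
    ∣ (+ mc n k / 1) - (+ n / 1) * ((+ k / 1) - a) ∣ ≤ ε * ((+ n / 1) * ((+ k / 1) - a))
corollary1 (suc k′) _ a isA ε 0<ε = N , close
  where
  open Rationals
  open MaxCutBounds (suc k′) a isA using (errorTerm; mc-close)
  k = suc k′
  c = ι k - a
  εc>0 : Positive (ε * c)
  εc>0 = ℚₚ.pos*pos⇒pos ε {{positive 0<ε}} c {{AlternatingCycle.k-a-positive k′ isA}}
  large = archimedean (ε * c) εc>0 errorTerm
  N = suc (k ℕ.+ k) ℕ.+ proj₁ large
  close : (n : ℕ) → n ≥ N → ∣ ι (mc n k) - ι n * c ∣ ≤ ε * (ι n * c)
  close n n≥N = ℚₚ.≤-trans
    (subst (λ m → ∣ ι (mc m k) - ι m * c ∣ ≤ ι errorTerm) (proj₂ cyclic) (mc-close (proj₁ cyclic)))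
    (subst (ι errorTerm ≤_) reassoc (proj₂ large n (ℕₚ.≤-trans (ℕₚ.m≤n+m _ (suc (k ℕ.+ k))) n≥N)))
    where
    cyclic = ≥2k+1⇒≡k+1+M+k k (ℕₚ.≤-trans (ℕₚ.m≤m+n (suc (k ℕ.+ k)) _) n≥N)
    reassoc : ι n * (ε * c) ≡ ε * (ι n * c)
    reassoc = trans (sym (ℚₚ.*-assoc (ι n) ε c)) (trans (cong (_* c) (ℚₚ.*-comm (ι n) ε)) (ℚₚ.*-assoc ε (ι n) c))
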